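{- For every element $x$ of an MV-monoidal algebra, $0\le x\le1$ in the lattice order.
   Context: An MV-monoidal algebra is an algebra $\langle A;\oplus,\odot,\vee,\wedge,0,1\rangle$ (arities $2,2,2,2,0,0$) satisfying: $\langle A;\vee,\wedge\rangle$ is a distributive lattice; $\langle A;\oplus,0\rangle$ and $\langle A;\odot,1\rangle$ are commutative monoids; $\oplus$ and $\odot$ both distribute over both $\vee$ and $\wedge$; $(x\oplus y)\odot((x\odot y)\oplus z)=(x\odot(y\oplus z))\oplus(y\odot z)$; $(x\odot y)\oplus((x\oplus y)\odot z)=(x\oplus(y\odot z))\odot(y\oplus z)$; $(x\odot y)\oplus z=((x\oplus y)\odot((x\odot y)\oplus z))\vee z$; $(x\oplus y)\odot z=((x\odot y)\oplus((x\oplus y)\odot z))\wedge z$. The order is $x\le y\iff x\vee y=y$. -}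

module Defs where

open import Level using (Level; suc)
open import Relation.Binary.PropositionalEquality using (_≡_)
open import Algebra.Core using (Op₂)
open import Algebra.Structures using (IsCommutativeMonoid)
open import Algebra.Lattice.Structures using (IsDistributiveLattice)
import Algebra.Definitions as Defn

-- An MV-monoidal algebra ⟨A; ⊕, ⊙, ∨, ∧, 0, 1⟩, with equality the
-- propositional equality on the carrier (it is an equationally defined algebra).
record MVMonoidalAlgebra (a : Level) : Set (suc a) where
  infixl 7 _⊙_
  infixl 6 _⊕_
  infixl 5 _∨_
  infixl 6 _∧_
  field
    Carrier : Set a
    _⊕_ _⊙_ _∨_ _∧_ : Op₂ Carrier
    𝟘 𝟙 : Carrier
    isDistributiveLattice : IsDistributiveLattice _≡_ _∨_ _∧_
    ⊕-isCommutativeMonoid : IsCommutativeMonoid _≡_ _⊕_ 𝟘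
    ⊙-isCommutativeMonoid : IsCommutativeMonoid _≡_ _⊙_ 𝟙
    ⊕-distrib-∨ : Defn._DistributesOver_ _≡_ _⊕_ _∨_
    ⊕-distrib-∧ : Defn._DistributesOver_ _≡_ _⊕_ _∧_
    ⊙-distrib-∨ : Defn._DistributesOver_ _≡_ _⊙_ _∨_
    ⊙-distrib-∧ : Defn._DistributesOver_ _≡_ _⊙_ _∧_
    ax1 : ∀ x y z → (x ⊕ y) ⊙ ((x ⊙ y) ⊕ z) ≡ (x ⊙ (y ⊕ z)) ⊕ (y ⊙ z)
    ax2 : ∀ x y z → (x ⊙ y) ⊕ ((x ⊕ y) ⊙ z) ≡ (x ⊕ (y ⊙ z)) ⊙ (y ⊕ z)
    ax3 : ∀ x y z → (x ⊙ y) ⊕ z ≡ ((x ⊕ y) ⊙ ((x ⊙ y) ⊕ z)) ∨ z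
    ax4 : ∀ x y z → (x ⊕ y) ⊙ z ≡ ((x ⊙ y) ⊕ ((x ⊕ y) ⊙ z)) ∧ z

  _≤_ : Carrier → Carrier → Set a
  x ≤ y = x ∨ y ≡ y

-- The last two axioms exhibit (x ⊙ y) ⊕ z as a join with z and (x ⊕ y) ⊙ z as a
-- meet with z, so z ≤ (x ⊙ y) ⊕ z and (x ⊕ y) ⊙ z ≤ z. Taking y = 𝟙, z = 𝟘 in the
-- first and y = 𝟘, z = 𝟙 in the second, the units collapse the middle term to x.
module Submission where

open import Defs
open import Level using (Level)
open import Data.Product using (_×_; _,_)
open import Relation.Binary.PropositionalEquality using (_≡_; sym; trans; cong; subst; module ≡-Reasoning)
open import Algebra.Lattice.Structures using (IsDistributiveLattice)
open import Algebra.Lattice.Bundles using (Lattice)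
import Algebra.Lattice.Properties.Lattice as LatticeProperties
open import Algebra.Structures using (IsCommutativeMonoid)

module MVMonoidalAlgebraProperties {a : Level} (M : MVMonoidalAlgebra a) where
  open MVMonoidalAlgebra M
  open IsDistributiveLattice isDistributiveLattice using (isLattice; ∨-comm; ∨-assoc; ∧-comm; ∨-absorbs-∧)
  open IsCommutativeMonoid ⊕-isCommutativeMonoid using () renaming (identityʳ to ⊕-identityʳ)
  open IsCommutativeMonoid ⊙-isCommutativeMonoid using () renaming (identityʳ to ⊙-identityʳ)
  open ≡-Reasoning

  lattice : Lattice a a
  lattice = record { isLattice = isLattice }

  open LatticeProperties lattice using (∨-idem)

  y≤x∨y : ∀ x y → y ≤ (x ∨ y)
  y≤x∨y x y = begin
    y ∨ (x ∨ y) ≡⟨ cong (y ∨_) (∨-comm x y) ⟩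
    y ∨ (y ∨ x) ≡⟨ sym (∨-assoc y y x) ⟩
    (y ∨ y) ∨ x ≡⟨ cong (_∨ x) (∨-idem y) ⟩
    y ∨ x       ≡⟨ ∨-comm y x ⟩
    x ∨ y       ∎

  x∧y≤y : ∀ x y → (x ∧ y) ≤ y
  x∧y≤y x y = begin
    (x ∧ y) ∨ y ≡⟨ ∨-comm (x ∧ y) y ⟩
    y ∨ (x ∧ y) ≡⟨ cong (y ∨_) (∧-comm x y) ⟩
    y ∨ (y ∧ x) ≡⟨ ∨-absorbs-∧ y x ⟩
    y           ∎

  z≤[x⊙y]⊕z : ∀ x y z → z ≤ ((x ⊙ y) ⊕ z)
  z≤[x⊙y]⊕z x y z = subst (z ≤_) (sym (ax3 x y z)) (y≤x∨y _ z)

  [x⊕y]⊙z≤z : ∀ x y z → ((x ⊕ y) ⊙ z) ≤ z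
  [x⊕y]⊙z≤z x y z = subst (_≤ z) (sym (ax4 x y z)) (x∧y≤y _ z)

  𝟘≤x : ∀ x → 𝟘 ≤ x
  𝟘≤x x = subst (𝟘 ≤_) [x⊙𝟙]⊕𝟘≡x (z≤[x⊙y]⊕z x 𝟙 𝟘)
    where
    [x⊙𝟙]⊕𝟘≡x : (x ⊙ 𝟙) ⊕ 𝟘 ≡ x
    [x⊙𝟙]⊕𝟘≡x = trans (⊕-identityʳ (x ⊙ 𝟙)) (⊙-identityʳ x)

  x≤𝟙 : ∀ x → x ≤ 𝟙
  x≤𝟙 x = subst (_≤ 𝟙) [x⊕𝟘]⊙𝟙≡x ([x⊕y]⊙z≤z x 𝟘 𝟙)
    where
    [x⊕𝟘]⊙𝟙≡x : (x ⊕ 𝟘) ⊙ 𝟙 ≡ x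
    [x⊕𝟘]⊙𝟙≡x = trans (⊙-identityʳ (x ⊕ 𝟘)) (⊕-identityʳ x)

lemma6p5 : {a : Level} (M : MVMonoidalAlgebra a) →
    let open MVMonoidalAlgebra M in
    ∀ (x : Carrier) → (𝟘 ≤ x) × (x ≤ 𝟙)
lemma6p5 M x = 𝟘≤x x , x≤𝟙 x
  where open MVMonoidalAlgebraProperties M
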